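{- A connected graph of order $n$ with at most $k$ cycles has cop throttling number at most $2\sqrt{n}+k$. In particular, every connected unicyclic graph $G$ of order $n$ satisfies $\operatorname{th}_c(G)\le 2\sqrt{n}+1$.
   Context: Graphs are finite, simple and undirected. In the game of Cops and Robbers, the cops first choose a multiset $S$ of vertices, then the robber chooses a vertex; in each round every cop moves to an adjacent vertex or stays, then the robber does likewise; perfect information; capture occurs when a cop occupies the robber's vertex. $\operatorname{capt}(G;S)$ is the optimal-play number of rounds to capture with cops starting on $S$ ($\infty$ if not guaranteed); $\operatorname{capt}_k(G)=\min_{|S|=k}\operatorname{capt}(G;S)$; the cop throttling number is $\operatorname{th}_c(G)=\min_k\{k+\operatorname{capt}_k(G)\}$. -}

module Defs where

open import Data.Nat using (ℕ; zero; suc; _+_; _*_; _∸_; _≤_)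
open import Data.Fin using (Fin)
open import Data.Bool using (Bool; true; false; T)
open import Data.Vec using (Vec; lookup)
open import Data.List using (List; []; _∷_; _++_; [_]; zip; length)
open import Data.List.Relation.Unary.All using (All)
open import Data.List.Relation.Unary.Any using (Any)
open import Data.List.Relation.Unary.Unique.Propositional using (Unique)
open import Data.List.Membership.Propositional using (_∈_)
open import Data.Product using (Σ; ∃; _×_; _,_)
open import Data.Sum using (_⊎_)
open import Data.Empty using (⊥)
open import Function.Bundles using (_⇔_)
open import Relation.Binary.PropositionalEquality using (_≡_)
open import Relation.Binary.Construct.Closure.ReflexiveTransitive using (Star)

record Graph (n : ℕ) : Set where
  field
    adj     : Fin n → Fin n → Bool
    adj-sym : ∀ u v → adj u v ≡ adj v u
    adj-irr : ∀ v → adj v v ≡ false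

module _ {n : ℕ} (G : Graph n) where
  open Graph G

  Adj : Fin n → Fin n → Set
  Adj u v = T (adj u v)

  Connected : Set
  Connected = ∀ u v → Star Adj u v

  cyclicPairs : List (Fin n) → List (Fin n × Fin n)
  cyclicPairs []       = []
  cyclicPairs (x ∷ xs) = zip (x ∷ xs) (xs ++ [ x ])

  record Cycle : Set where
    field
      verts    : List (Fin n)
      long     : 3 ≤ length verts
      distinct : Unique verts
      edges-ok : All (λ p → Adj (Data.Product.proj₁ p) (Data.Product.proj₂ p)) (cyclicPairs verts)

  EdgeOf : Cycle → Fin n → Fin n → Set
  EdgeOf c u v = ((u , v) ∈ cyclicPairs (Cycle.verts c)) ⊎ ((v , u) ∈ cyclicPairs (Cycle.verts c))

  -- two cycles are the same subgraph iff they have the same edge set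
  SameCycle : Cycle → Cycle → Set
  SameCycle c d = ∀ u v → EdgeOf c u v ⇔ EdgeOf d u v

  AtMostCycles : ℕ → Set
  AtMostCycles k = Σ (List Cycle) λ cs → length cs ≤ k × (∀ c → Any (SameCycle c) cs)

  Unicyclic : Set
  Unicyclic = Cycle × AtMostCycles 1

  Caught : {m : ℕ} → Vec (Fin n) m → Fin n → Set
  Caught {m} cs r = ∃ λ (i : Fin m) → lookup cs i ≡ r

  CopMove : {m : ℕ} → Vec (Fin n) m → Vec (Fin n) m → Set
  CopMove {m} cs cs' = ∀ (i : Fin m) → lookup cs' i ≡ lookup cs i ⊎ Adj (lookup cs i) (lookup cs' i)

  -- CopsWin t cs r : cops at cs (to move) against robber at r can force
  -- capture within t further rounds.
  CopsWin : {m : ℕ} → ℕ → Vec (Fin n) m → Fin n → Set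
  CopsWin zero    cs r = Caught cs r
  CopsWin (suc t) cs r =
    Caught cs r ⊎
    Σ _ λ cs' → CopMove cs cs' ×
      (Caught cs' r ⊎ (∀ r' → (r' ≡ r ⊎ Adj r r') → CopsWin t cs' r'))

  CaptLE : {m : ℕ} → Vec (Fin n) m → ℕ → Set
  CaptLE S t = ∀ r → CopsWin t S r

  CaptkLE : ℕ → ℕ → Set
  CaptkLE k t = Σ (Vec (Fin n) k) λ S → CaptLE S t

  -- th_c(G) ≤ x, i.e. min_k (k + capt_k(G)) ≤ x
  ThrottleLE : ℕ → Set
  ThrottleLE x = Σ ℕ λ k → Σ ℕ λ t → CaptkLE k t × k + t ≤ x

  -- th_c(G) ≤ 2√n + k, for natural-valued th_c:
  -- some value x with th_c(G) ≤ x and x - k ≤ 2√n, i.e. (x ∸ k)² ≤ 4n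
  ThrottleLE-2sqrt+ : ℕ → Set
  ThrottleLE-2sqrt+ k = Σ ℕ λ x → ThrottleLE x × (x ∸ k) * (x ∸ k) ≤ 4 * n

-- Fix a breadth-first spanning tree of G. A non-tree edge uv closes a cycle with the tree
-- (from u up to the deepest common ancestor, down to v, and back along uv) whose only
-- non-tree edge is uv, so distinct non-tree edges give distinct cycles and there are at
-- most k of them. A cop on one endpoint of each non-tree edge confines the robber to tree
-- edges. Choose b with b² < n ≤ (b + 1)² and add a cop on every vertex whose depth is
-- ≡ i (mod b + 1): the cop on the deepest such ancestor of the robber walks down the tree
-- path towards it, and the robber, who can pass neither that cop nor a guarded depth, is
-- caught within b rounds. Some class i has at most (n + b)/(b + 1) vertices, and
-- k + (n + b)/(b + 1) + b ≤ k + 2√n.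
module Submission where

open import Defs

open import Data.Bool using (true; false; T)
open import Data.Fin using (Fin; zero; suc; toℕ; _↑ˡ_; _↑ʳ_) renaming (_≟_ to _≟ᶠ_; _<_ to _<ᶠ_)
open import Data.Fin.Properties using (any?; pigeonhole; toℕ-injective; nonZeroIndex)
open import Data.List as List using (List; []; _∷_; _++_; [_]; length; map; filter; zip; applyUpTo; allFin; cartesianProduct)
open import Data.List.Membership.Propositional using (_∈_)
open import Data.List.Membership.Propositional.Properties
  using (∈-lookup; ∈-filter⁺; ∈-filter⁻; ∈-map⁺; ∈-++⁺ʳ; ∈-cartesianProduct⁺; ∈-allFin)
open import Data.List.Properties using (filter-accept; filter-reject; length-applyUpTo; length-map; length-++; length-tabulate)
open import Data.List.Relation.Unary.All as All using (All; []; _∷_)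
open import Data.List.Relation.Unary.AllPairs using (_∷_)
open import Data.List.Relation.Unary.Any as Any using (here; there)
open import Data.List.Relation.Unary.Any.Properties using (lookup-index)
open import Data.List.Relation.Unary.Unique.Propositional using (Unique)
open import Data.List.Relation.Unary.Unique.Propositional.Properties
  using (applyUpTo⁺₁; filter⁺; cartesianProduct⁺; allFin⁺)
open import Data.Nat
  using (ℕ; zero; suc; pred; _+_; _*_; _∸_; _%_; _/_; _≤_; _<_; _≟_; _≤?_; _<?_; z≤n; s≤s; z<s; s<s; s<s⁻¹; >-nonZero⁻¹)
open import Data.Nat.DivMod using (m≡m%n+[m/n]*n; [m+kn]%n≡m%n; m%n<n; m<n⇒m%n≡m)
open import Data.Nat.GeneralisedArithmetic using (iterate)
open import Data.Nat.Properties
open import Data.Nat.Tactic.RingSolver using (solve-∀)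
open import Data.Product using (∃; _×_; _,_; proj₁; proj₂; uncurry)
open import Data.Sum using (_⊎_; inj₁; inj₂; swap)
open import Data.Vec using (Vec; []; _∷_; lookup; _[_]≔_; fromList) renaming (_++_ to _++ᵛ_)
open import Data.Vec.Membership.Propositional.Properties using (∈-fromList⁺)
open import Data.Vec.Properties using (lookup-++ˡ; lookup-++ʳ; lookup∘update; lookup∘update′; []≔-lookup)
import Data.Vec.Relation.Unary.Any as VecAny
import Data.Vec.Relation.Unary.Any.Properties as VecAny
open import Function.Base using (_∘_)
open import Function.Bundles using (Equivalence)
open import Relation.Binary.Construct.Closure.ReflexiveTransitive using (Star; ε; _◅_)
open import Relation.Binary.Definitions using (tri<; tri≈; tri>)
open import Relation.Binary.PropositionalEquality hiding ([_])
open import Relation.Nullary using (¬_; Dec; yes; no; contradiction)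
open import Relation.Nullary.Decidable using (_×-dec_; _⊎-dec_; ¬?)
open import Relation.Unary using (Decidable)

leastWitness : {P : ℕ → Set} → Decidable P → ∀ {L} → P L →
               ∃ λ m → P m × (∀ {i} → i < m → ¬ P i)
leastWitness P? pL with P? 0
... | yes p0 = 0 , p0 , λ ()
leastWitness P? {zero}  p0 | no ¬p0 = contradiction p0 ¬p0
leastWitness P? {suc L} pL | no ¬p0 with leastWitness (P? ∘ suc) pL
... | m , pm , below = suc m , pm , λ { {zero} _ → ¬p0 ; {suc i} i<1+m → below (s<s⁻¹ i<1+m) }

greatestWitnessBelow : {P : ℕ → Set} → Decidable P → ∀ D → ∃ (λ e → e ≤ D × P e) →
                       ∃ λ e → e ≤ D × P e × (∀ {i} → e < i → i ≤ D → ¬ P i)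
greatestWitnessBelow P? D w with P? D
... | yes pD = D , ≤-refl , pD , λ D<i i≤D → contradiction i≤D (<⇒≱ D<i)
greatestWitnessBelow P? zero    (_ , z≤n , p0) | no ¬p0 = contradiction p0 ¬p0
greatestWitnessBelow {P} P? (suc D) (e , e≤1+D , pe) | no ¬pD
  with greatestWitnessBelow P? D (e , m<1+n⇒m≤n (≤∧≢⇒< e≤1+D λ { refl → ¬pD pe }) , pe)
... | g , g≤D , pg , above = g , m≤n⇒m≤1+n g≤D , pg , above′
  where
  above′ : ∀ {i} → g < i → i ≤ suc D → ¬ P i
  above′ g<i i≤1+D with m≤n⇒m<n∨m≡n i≤1+D
  ... | inj₁ i<1+D = above g<i (m<1+n⇒m≤n i<1+D)
  ... | inj₂ refl  = ¬pD

∸-suc : ∀ {e d} → suc e ≤ d → d ∸ e ≡ suc (d ∸ suc e)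
∸-suc {zero}  {suc d} _          = refl
∸-suc {suc e} {suc d} (s≤s e<d) = ∸-suc e<d

<∸⇒<∸ : ∀ {i e d} → e ≤ d → i < d ∸ e → e < d ∸ i
<∸⇒<∸ {i} {e} {d} e≤d i<d∸e =
  m+n≤o⇒m≤o∸n (suc e) (subst (_≤ d) (cong suc (+-comm i e)) (m≤o∸n⇒m+n≤o (suc i) e≤d i<d∸e))

sumBelow : (ℕ → ℕ) → ℕ → ℕ
sumBelow g zero    = 0
sumBelow g (suc a) = sumBelow g a + g a

sumBelow-cong : ∀ {g h} a → (∀ i → g i ≡ h i) → sumBelow g a ≡ sumBelow h a
sumBelow-cong zero    g≡h = refl
sumBelow-cong (suc a) g≡h = cong₂ _+_ (sumBelow-cong a g≡h) (g≡h a)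

sumBelow-+ : ∀ g h a → sumBelow (λ i → g i + h i) a ≡ sumBelow g a + sumBelow h a
sumBelow-+ g h zero    = refl
sumBelow-+ g h (suc a) = begin
  sumBelow (λ i → g i + h i) a + (g a + h a)      ≡⟨ cong (_+ (g a + h a)) (sumBelow-+ g h a) ⟩
  (sumBelow g a + sumBelow h a) + (g a + h a)     ≡⟨ interchange (sumBelow g a) (sumBelow h a) (g a) (h a) ⟩
  (sumBelow g a + g a) + (sumBelow h a + h a)     ∎
  where
  open ≡-Reasoning
  interchange : ∀ w x y z → (w + x) + (y + z) ≡ (w + y) + (x + z)
  interchange = solve-∀

*-≤-sumBelow : ∀ g a {c} → (∀ {i} → i < a → c ≤ g i) → a * c ≤ sumBelow g a
*-≤-sumBelow g zero    c≤g = z≤n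
*-≤-sumBelow g (suc a) {c} c≤g = begin
  c + a * c            ≡⟨ +-comm c (a * c) ⟩
  a * c + c            ≤⟨ +-mono-≤ (*-≤-sumBelow g a (c≤g ∘ m≤n⇒m≤1+n)) (c≤g ≤-refl) ⟩
  sumBelow g a + g a   ∎
  where open ≤-Reasoning

minimiserBelow : ∀ (g : ℕ → ℕ) a → ∃ λ i → i ≤ a × (∀ {j} → j ≤ a → g i ≤ g j)
minimiserBelow g zero = 0 , z≤n , λ { z≤n → ≤-refl }
minimiserBelow g (suc a) with minimiserBelow g a
... | i , i≤a , minimal with g (suc a) ≤? g i
...   | yes gsa≤gi = suc a , ≤-refl , λ j≤1+a → bySplit (m≤n⇒m<n∨m≡n j≤1+a)
  where
  bySplit : ∀ {j} → j < suc a ⊎ j ≡ suc a → g (suc a) ≤ g j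
  bySplit (inj₁ j<1+a) = ≤-trans gsa≤gi (minimal (m<1+n⇒m≤n j<1+a))
  bySplit (inj₂ refl)  = ≤-refl
...   | no gsa≰gi = i , m≤n⇒m≤1+n i≤a , λ j≤1+a → bySplit (m≤n⇒m<n∨m≡n j≤1+a)
  where
  bySplit : ∀ {j} → j < suc a ⊎ j ≡ suc a → g i ≤ g j
  bySplit (inj₁ j<1+a) = minimal (m<1+n⇒m≤n j<1+a)
  bySplit (inj₂ refl)  = <⇒≤ (≰⇒> gsa≰gi)

termBelowAverage : ∀ (g : ℕ → ℕ) a → ∃ λ i → i ≤ a × suc a * g i ≤ sumBelow g (suc a)
termBelowAverage g a with minimiserBelow g a
... | i , i≤a , minimal = i , i≤a , *-≤-sumBelow g (suc a) (minimal ∘ m<1+n⇒m≤n)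

indicator : ℕ → ℕ → ℕ
indicator y i with y ≟ i
... | yes _ = 1
... | no  _ = 0

sumBelow-indicator-≥ : ∀ {y} a → a ≤ y → sumBelow (indicator y) a ≡ 0
sumBelow-indicator-≥ zero    _ = refl
sumBelow-indicator-≥ {y} (suc a) a<y with y ≟ a
... | yes refl = contradiction a<y (n≮n y)
... | no  _    = trans (+-identityʳ _) (sumBelow-indicator-≥ a (<⇒≤ a<y))

sumBelow-indicator-< : ∀ {y} a → y < a → sumBelow (indicator y) a ≡ 1
sumBelow-indicator-< {y} (suc a) y<1+a with y ≟ a
... | yes refl = cong (_+ 1) (sumBelow-indicator-≥ y ≤-refl)
... | no  y≢a  = trans (+-identityʳ _) (sumBelow-indicator-< a (≤∧≢⇒< (m<1+n⇒m≤n y<1+a) y≢a))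

module _ {A : Set} (key : A → ℕ) where

  countKey : ℕ → List A → ℕ
  countKey i xs = length (filter (λ x → key x ≟ i) xs)

  countKey-∷ : ∀ i x xs → countKey i (x ∷ xs) ≡ indicator (key x) i + countKey i xs
  countKey-∷ i x xs with key x ≟ i
  ... | yes kx≡i = cong length (filter-accept (λ y → key y ≟ i) kx≡i)
  ... | no  kx≢i = cong length (filter-reject (λ y → key y ≟ i) kx≢i)

  sumBelow-countKey : ∀ a xs → All (λ x → key x < a) xs → sumBelow (λ i → countKey i xs) a ≡ length xs
  sumBelow-countKey a []       []           = sumBelow-zero a
    where
    sumBelow-zero : ∀ a → sumBelow (λ _ → 0) a ≡ 0
    sumBelow-zero zero    = refl
    sumBelow-zero (suc a) = trans (+-identityʳ _) (sumBelow-zero a)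
  sumBelow-countKey a (x ∷ xs) (x<a ∷ xs<a) = begin
    sumBelow (λ i → countKey i (x ∷ xs)) a
      ≡⟨ sumBelow-cong a (λ i → countKey-∷ i x xs) ⟩
    sumBelow (λ i → indicator (key x) i + countKey i xs) a
      ≡⟨ sumBelow-+ (indicator (key x)) (λ i → countKey i xs) a ⟩
    sumBelow (indicator (key x)) a + sumBelow (λ i → countKey i xs) a
      ≡⟨ cong₂ _+_ (sumBelow-indicator-< a x<a) (sumBelow-countKey a xs xs<a) ⟩
    suc (length xs)
      ∎
    where open ≡-Reasoning

betweenSquares : ∀ n → 1 ≤ n → ∃ λ b → b * b < n × n ≤ suc b * suc b
betweenSquares (suc zero)    _ = 0 , s≤s z≤n , s≤s z≤n
betweenSquares (suc (suc n)) _ with betweenSquares (suc n) (s≤s z≤n)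
... | b , b²<1+n , 1+n≤[1+b]² with suc (suc n) ≤? suc b * suc b
...   | yes 2+n≤[1+b]² = b , m<n⇒m<1+n b²<1+n , 2+n≤[1+b]²
...   | no  2+n≰[1+b]² = suc b , ≰⇒> 2+n≰[1+b]² , (begin
  suc (suc n)                         ≤⟨ s≤s 1+n≤[1+b]² ⟩
  suc (suc b * suc b)                 ≤⟨ m≤m+n _ _ ⟩
  suc (suc b * suc b) + (2 * b + 2)   ≡⟨ expand b ⟩
  suc (suc b) * suc (suc b)           ∎)
  where
  open ≤-Reasoning
  expand : ∀ b → suc (suc b * suc b) + (2 * b + 2) ≡ suc (suc b) * suc (suc b)
  expand = solve-∀

[m+b]²≤4n : ∀ {n b m} → b * b < n → n ≤ suc b * suc b → suc b * m ≤ n + b →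
            (m + b) * (m + b) ≤ 4 * n
[m+b]²≤4n {n} {b} {m} b²<n n≤[1+b]² [1+b]m≤n+b with m≤n⇒m<n∨m≡n m≤1+b
  where
  m≤1+b : m ≤ suc b
  m≤1+b = m<1+n⇒m≤n (*-cancelˡ-< (suc b) _ _ (begin-strict
    suc b * m                ≤⟨ [1+b]m≤n+b ⟩
    n + b                    ≤⟨ +-monoˡ-≤ b n≤[1+b]² ⟩
    suc b * suc b + b        <⟨ n<1+n _ ⟩
    suc (suc b * suc b + b)  ≡⟨ expand b ⟩
    suc b * suc (suc b)      ∎))
    where
    open ≤-Reasoning
    expand : ∀ b → suc (suc b * suc b + b) ≡ suc b * suc (suc b)
    expand = solve-∀
... | inj₁ m<1+b = begin
  (m + b) * (m + b)   ≤⟨ *-mono-≤ (+-monoˡ-≤ b (m<1+n⇒m≤n m<1+b)) (+-monoˡ-≤ b (m<1+n⇒m≤n m<1+b)) ⟩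
  (b + b) * (b + b)   ≡⟨ expand b ⟩
  4 * (b * b)         ≤⟨ *-monoʳ-≤ 4 (<⇒≤ b²<n) ⟩
  4 * n               ∎
  where
  open ≤-Reasoning
  expand : ∀ b → (b + b) * (b + b) ≡ 4 * (b * b)
  expand = solve-∀
... | inj₂ refl = +-cancelʳ-≤ (4 * b + 3) _ _ (begin
  (suc b + b) * (suc b + b) + (4 * b + 3)   ≡⟨ expand b ⟩
  4 * (suc b * suc b)                       ≤⟨ *-monoʳ-≤ 4 [1+b]m≤n+b ⟩
  4 * (n + b)                               ≡⟨ *-distribˡ-+ 4 n b ⟩
  4 * n + 4 * b                             ≤⟨ +-monoʳ-≤ (4 * n) (m≤m+n (4 * b) 3) ⟩
  4 * n + (4 * b + 3)                       ∎)
  where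
  open ≤-Reasoning
  expand : ∀ b → (suc b + b) * (suc b + b) + (4 * b + 3) ≡ 4 * (suc b * suc b)
  expand = solve-∀

Unique⇒lookup-injective : ∀ {A : Set} {xs : List A} → Unique xs →
                          ∀ {i j} → i <ᶠ j → List.lookup xs i ≢ List.lookup xs j
Unique⇒lookup-injective (x∉xs ∷ _)  {zero}  {suc j} _         = All.lookup x∉xs (∈-lookup j)
Unique⇒lookup-injective (_ ∷ unique) {suc i} {suc j} (s<s i<j) = Unique⇒lookup-injective unique i<j

All-cyclicZip : ∀ {A : Set} {R : A → A → Set} (f : ℕ → A) {z} m →
                (∀ {i} → i < m → R (f i) (f (suc i))) → R (f m) z →
                All (uncurry R) (zip (applyUpTo f (suc m)) (applyUpTo (f ∘ suc) m ++ [ z ]))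
All-cyclicZip f zero    steps close = close ∷ []
All-cyclicZip f (suc m) steps close = steps z<s ∷ All-cyclicZip (f ∘ suc) m (steps ∘ s<s) close

closing∈cyclicZip : ∀ {A : Set} (f : ℕ → A) {z} m →
                    (f m , z) ∈ zip (applyUpTo f (suc m)) (applyUpTo (f ∘ suc) m ++ [ z ])
closing∈cyclicZip f zero    = here refl
closing∈cyclicZip f (suc m) = there (closing∈cyclicZip (f ∘ suc) m)

module _ {n : ℕ} (G : Graph n) where
  open Graph G

  Adj-sym : ∀ {u v} → Adj G u v → Adj G v u
  Adj-sym {u} {v} = subst T (adj-sym u v)

  Adj-irrefl : ∀ {u v} → Adj G u v → u ≢ v
  Adj-irrefl {u} uv refl = subst T (adj-irr u) uv

  Adj? : ∀ u v → Dec (Adj G u v)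
  Adj? u v with adj u v
  ... | true  = yes _
  ... | false = no λ ()

  caught? : ∀ {m} (cs : Vec (Fin n) m) r → Dec (Caught G cs r)
  caught? cs r = any? (λ i → lookup cs i ≟ᶠ r)

  caught-++ˡ : ∀ {m₁ m₂ r} (xs : Vec (Fin n) m₁) (ys : Vec (Fin n) m₂) → Caught G xs r → Caught G (xs ++ᵛ ys) r
  caught-++ˡ {m₂ = m₂} xs ys (i , xsᵢ≡r) = i ↑ˡ m₂ , trans (lookup-++ˡ xs ys i) xsᵢ≡r

  caught-++ʳ : ∀ {m₁ m₂ r} (xs : Vec (Fin n) m₁) (ys : Vec (Fin n) m₂) → Caught G ys r → Caught G (xs ++ᵛ ys) r
  caught-++ʳ {m₁} xs ys (i , ysᵢ≡r) = m₁ ↑ʳ i , trans (lookup-++ʳ xs ys i) ysᵢ≡r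

  caught⇒copsWin : ∀ {m r} t (cs : Vec (Fin n) m) → Caught G cs r → CopsWin G t cs r
  caught⇒copsWin zero    cs caught = caught
  caught⇒copsWin (suc t) cs caught = inj₁ caught

  caught-fromList : ∀ {r xs} → r ∈ xs → Caught G (fromList xs) r
  caught-fromList r∈xs = VecAny.index (∈-fromList⁺ r∈xs) , sym (VecAny.lookup-index (∈-fromList⁺ r∈xs))

  copMove-++ʳ : ∀ {m₁ m₂} (xs : Vec (Fin n) m₁) {ys ys′ : Vec (Fin n) m₂} →
                CopMove G ys ys′ → CopMove G (xs ++ᵛ ys) (xs ++ᵛ ys′)
  copMove-++ʳ []       ys→ys′ i       = ys→ys′ i
  copMove-++ʳ (_ ∷ _)  ys→ys′ zero    = inj₁ refl
  copMove-++ʳ (_ ∷ xs) {ys} {ys′} ys→ys′ (suc i) = copMove-++ʳ xs {ys} {ys′} ys→ys′ i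

  copMove-update : ∀ {m p p′} (cs : Vec (Fin n) m) c → Adj G p p′ → CopMove G (cs [ c ]≔ p) (cs [ c ]≔ p′)
  copMove-update {p = p} {p′} cs c pp′ i with i ≟ᶠ c
  ... | yes refl = inj₂ (subst₂ (Adj G) (sym (lookup∘update c cs p)) (sym (lookup∘update c cs p′)) pp′)
  ... | no  i≢c  = inj₁ (trans (lookup∘update′ i≢c cs p′) (sym (lookup∘update′ i≢c cs p)))

record SpanningTree {n : ℕ} (G : Graph n) : Set where
  field
    root         : Fin n
    depth        : Fin n → ℕ
    parent       : Fin n → Fin n
    depth-parent : ∀ v → depth (parent v) ≡ pred (depth v)
    parent-adj   : ∀ {v} → 0 < depth v → Adj G (parent v) v
    depth≡0⇒root : ∀ {v} → depth v ≡ 0 → v ≡ root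

module _ {n : ℕ} {G : Graph n} (tree : SpanningTree G) where
  open SpanningTree tree

  TreeEdge : Fin n → Fin n → Set
  TreeEdge x y = x ≡ parent y ⊎ y ≡ parent x

  NonTreeEdge : Fin n → Fin n → Set
  NonTreeEdge u v = Adj G u v × ¬ TreeEdge u v

  NonTreeEdge-sym : ∀ {u v} → NonTreeEdge u v → NonTreeEdge v u
  NonTreeEdge-sym (uv , ¬treeEdge) = Adj-sym G uv , ¬treeEdge ∘ swap

module BreadthFirst {n : ℕ} (G : Graph n) (connected : Connected G) (root : Fin n) where

  WithinDistance : ℕ → Fin n → Set
  WithinDistance zero    v = v ≡ root
  WithinDistance (suc j) v = WithinDistance j v ⊎ ∃ λ w → WithinDistance j w × Adj G w v

  withinDistance? : ∀ j → Decidable (WithinDistance j)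
  withinDistance? zero    v = v ≟ᶠ root
  withinDistance? (suc j) v = withinDistance? j v ⊎-dec any? (λ w → withinDistance? j w ×-dec Adj? G w v)

  walk⇒withinDistance : ∀ {j u v} → WithinDistance j u → Star (Adj G) u v → ∃ λ L → WithinDistance L v
  walk⇒withinDistance {j} u≤j ε          = j , u≤j
  walk⇒withinDistance {u = u} u≤j (uw ◅ wv) = walk⇒withinDistance (inj₂ (u , u≤j , uw)) wv

  leastDistance : ∀ v → ∃ λ d → WithinDistance d v × (∀ {i} → i < d → ¬ WithinDistance i v)
  leastDistance v = leastWitness (λ j → withinDistance? j v) (proj₂ (walk⇒withinDistance refl (connected root v)))

  distance : Fin n → ℕ
  distance v = proj₁ (leastDistance v)

  withinDistance-distance : ∀ v → WithinDistance (distance v) v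
  withinDistance-distance v = proj₁ (proj₂ (leastDistance v))

  distance-minimal : ∀ {j} v → WithinDistance j v → distance v ≤ j
  distance-minimal v v≤j = ≮⇒≥ λ j<d → proj₂ (proj₂ (leastDistance v)) j<d v≤j

  stepTowardsRoot : ∀ v → ∃ λ w → distance w ≡ pred (distance v) × (0 < distance v → Adj G w v)
  stepTowardsRoot v with distance v | withinDistance-distance v | proj₂ (proj₂ (leastDistance v))
  ... | zero  | refl                   | _       = root , n≤0⇒n≡0 (distance-minimal root refl) , λ ()
  ... | suc d | inj₁ v≤d               | minimal = contradiction v≤d (minimal ≤-refl)
  ... | suc d | inj₂ (w , w≤d , wv)    | minimal = w , ≤-antisym (distance-minimal w w≤d) d≤dw , λ _ → wv
    where
    d≤dw : d ≤ distance w
    d≤dw = ≮⇒≥ λ dw<d → minimal (s≤s dw<d) (inj₂ (w , withinDistance-distance w , wv))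

  bfsTree : SpanningTree G
  bfsTree = record
    { root         = root
    ; depth        = distance
    ; parent       = parent
    ; depth-parent = λ v → proj₁ (proj₂ (stepTowardsRoot v))
    ; parent-adj   = λ {v} → proj₂ (proj₂ (stepTowardsRoot v))
    ; depth≡0⇒root = λ {v} d≡0 → subst (λ j → WithinDistance j v) d≡0 (withinDistance-distance v)
    }
    where
    parent : Fin n → Fin n
    parent v = proj₁ (stepTowardsRoot v)

module Ancestors {n : ℕ} {G : Graph n} (tree : SpanningTree G) where
  open SpanningTree tree

  depth-iterate : ∀ k v → depth (iterate parent v k) ≡ depth v ∸ k
  depth-iterate zero    v = refl
  depth-iterate (suc k) v =
    trans (depth-iterate k (parent v)) (trans (cong (_∸ k) (depth-parent v)) (pred∸ (depth v)))
    where
    pred∸ : ∀ m → pred m ∸ k ≡ m ∸ suc k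
    pred∸ zero    = 0∸n≡0 k
    pred∸ (suc m) = refl

  parent-iterate : ∀ k v → parent (iterate parent v k) ≡ iterate parent v (suc k)
  parent-iterate zero    v = refl
  parent-iterate (suc k) v = parent-iterate k (parent v)

  iterate-adj : ∀ {k v} → k < depth v → Adj G (iterate parent v (suc k)) (iterate parent v k)
  iterate-adj {k} {v} k<d = subst (λ w → Adj G w (iterate parent v k)) (parent-iterate k v)
    (parent-adj (subst (0 <_) (sym (depth-iterate k v)) (m<n⇒0<n∸m k<d)))

  -- the ancestor of v at depth e (v itself when e > depth v)
  ancestor : Fin n → ℕ → Fin n
  ancestor v e = iterate parent v (depth v ∸ e)

  depth-ancestor : ∀ {e} v → e ≤ depth v → depth (ancestor v e) ≡ e
  depth-ancestor {e} v e≤d = trans (depth-iterate (depth v ∸ e) v) (m∸[m∸n]≡n e≤d)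

  ancestor-self : ∀ {e v} → depth v ≡ e → ancestor v e ≡ v
  ancestor-self {v = v} refl = cong (iterate parent v) (n∸n≡0 (depth v))

  ancestor-iterate : ∀ {k} v → k ≤ depth v → ancestor v (depth (iterate parent v k)) ≡ iterate parent v k
  ancestor-iterate {k} v k≤d = cong (iterate parent v) (trans (cong (depth v ∸_) (depth-iterate k v)) (m∸[m∸n]≡n k≤d))

  ancestor-parent : ∀ {e v} → suc e ≤ depth v → ancestor (parent v) e ≡ ancestor v e
  ancestor-parent {e} {v} e<d = begin
    iterate parent (parent v) (depth (parent v) ∸ e)   ≡⟨ cong (iterate parent (parent v) ∘ (_∸ e)) (depth-parent v) ⟩
    iterate parent (parent v) (pred (depth v) ∸ e)     ≡⟨ cong (iterate parent (parent v)) (pred∸ (depth v) e<d) ⟩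
    iterate parent v (suc (depth v ∸ suc e))           ≡⟨ cong (iterate parent v) (∸-suc e<d) ⟨
    iterate parent v (depth v ∸ e)                     ∎
    where
    open ≡-Reasoning
    pred∸ : ∀ d → suc e ≤ d → pred d ∸ e ≡ d ∸ suc e
    pred∸ (suc d) _ = refl

  depth-child : ∀ {w} → 0 < depth (parent w) → depth w ≡ suc (depth (parent w))
  depth-child {w} 0<dpw with depth w | depth-parent w
  ... | suc d | dpw≡d = cong suc (sym dpw≡d)
  ... | zero  | dpw≡0 = contradiction dpw≡0 (<⇒≢ 0<dpw ∘ sym)

  ancestor-adj : ∀ {e v} → suc e ≤ depth v → Adj G (ancestor v e) (ancestor v (suc e))
  ancestor-adj {e} {v} e<d = subst (λ k → Adj G (iterate parent v k) (ancestor v (suc e))) (sym (∸-suc e<d))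
    (iterate-adj (∸-monoʳ-< z<s e<d))

module FundamentalCycle {n : ℕ} {G : Graph n} (tree : SpanningTree G) where
  open SpanningTree tree
  open Ancestors tree

  module _ {u v : Fin n} (uv : NonTreeEdge tree u v) where

    private
      CommonAncestorAt : ℕ → Set
      CommonAncestorAt e = e ≤ depth v × ancestor u e ≡ ancestor v e

      meetingDepth : ∃ λ ℓ → ℓ ≤ depth u × CommonAncestorAt ℓ ×
                             (∀ {e} → ℓ < e → e ≤ depth u → ¬ CommonAncestorAt e)
      meetingDepth = greatestWitnessBelow (λ e → (e ≤? depth v) ×-dec (ancestor u e ≟ᶠ ancestor v e)) (depth u)
        (0 , z≤n , z≤n , trans (depth≡0⇒root (depth-ancestor u z≤n)) (sym (depth≡0⇒root (depth-ancestor v z≤n))))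

      ℓ : ℕ
      ℓ = proj₁ meetingDepth

      ℓ≤du : ℓ ≤ depth u
      ℓ≤du = proj₁ (proj₂ meetingDepth)

      meet : ancestor u ℓ ≡ ancestor v ℓ
      meet = proj₂ (proj₁ (proj₂ (proj₂ meetingDepth)))

      below-meet : ∀ {e} → ℓ < e → e ≤ depth u → e ≤ depth v → ancestor u e ≢ ancestor v e
      below-meet ℓ<e e≤du e≤dv eq = proj₂ (proj₂ (proj₂ meetingDepth)) ℓ<e e≤du (e≤dv , eq)

      b a m : ℕ
      b = depth u ∸ ℓ
      a = depth v ∸ ℓ
      m = b + a

      -- vertexAt 0, …, vertexAt m climbs from u to the common ancestor (at index b) and descends to v
      vertexAt : ℕ → Fin n
      vertexAt j with j ≤? b
      ... | yes _ = iterate parent u j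
      ... | no  _ = iterate parent v (m ∸ j)

      vertexAt-≤ : ∀ {j} → j ≤ b → vertexAt j ≡ iterate parent u j
      vertexAt-≤ {j} j≤b with j ≤? b
      ... | yes _   = refl
      ... | no  j≰b = contradiction j≤b j≰b

      vertexAt-≥ : ∀ {j} → b ≤ j → vertexAt j ≡ iterate parent v (m ∸ j)
      vertexAt-≥ {j} b≤j with j ≤? b
      ... | no _ = refl
      ... | yes j≤b with ≤-antisym j≤b b≤j
      ...   | refl = trans meet (cong (iterate parent v) (sym (m+n∸m≡n b a)))

      CycleStep : Fin n → Fin n → Set
      CycleStep x y = Adj G x y × (TreeEdge tree x y ⊎ (x ≡ v × y ≡ u))

      vertexAt-0 : vertexAt 0 ≡ u
      vertexAt-0 = vertexAt-≤ z≤n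

      vertexAt-m : vertexAt m ≡ v
      vertexAt-m = trans (vertexAt-≥ (m≤m+n b a)) (cong (iterate parent v) (n∸n≡0 m))

      a≤dv : a ≤ depth v
      a≤dv = m∸n≤m (depth v) ℓ

      step : ∀ {i} → i < m → CycleStep (vertexAt i) (vertexAt (suc i))
      step {i} i<m with b ≤? i
      ... | no b≰i = subst₂ CycleStep (sym (vertexAt-≤ (<⇒≤ i<b))) (sym (vertexAt-≤ i<b))
                       (Adj-sym G (iterate-adj (<-≤-trans i<b (m∸n≤m (depth u) ℓ))) ,
                        inj₁ (inj₂ (sym (parent-iterate i u))))
        where
        i<b : i < b
        i<b = ≰⇒> b≰i
      ... | yes b≤i = subst₂ CycleStep (sym (vertexAt-≥ b≤i)) (sym (vertexAt-≥ (m≤n⇒m≤1+n b≤i)))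
                        (subst (λ j → CycleStep (iterate parent v j) (iterate parent v (m ∸ suc i))) (sym (∸-suc i<m))
                          (iterate-adj k<dv , inj₁ (inj₁ (sym (parent-iterate (m ∸ suc i) v)))))
        where
        k<dv : m ∸ suc i < depth v
        k<dv = begin-strict
          m ∸ suc i   <⟨ ∸-monoʳ-< (s≤s b≤i) i<m ⟩
          m ∸ b       ≡⟨ m+n∸m≡n b a ⟩
          a           ≤⟨ a≤dv ⟩
          depth v     ∎
          where open ≤-Reasoning

      close : CycleStep (vertexAt m) (vertexAt 0)
      close = subst₂ CycleStep (sym vertexAt-m) (sym vertexAt-0) (Adj-sym G (proj₁ uv) , inj₂ (refl , refl))

      u≢v : u ≢ v
      u≢v = Adj-irrefl G (proj₁ uv)

      m≢0 : m ≢ 0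
      m≢0 m≡0 = u≢v (trans (sym vertexAt-0) (trans (cong vertexAt (sym m≡0)) vertexAt-m))

      m≢1 : m ≢ 1
      m≢1 m≡1 with proj₂ (subst₂ CycleStep vertexAt-0 (trans (cong vertexAt (sym m≡1)) vertexAt-m)
                                  (step (subst (0 <_) (sym m≡1) z<s)))
      ... | inj₁ treeEdge = proj₂ uv treeEdge
      ... | inj₂ (u≡v , _) = u≢v u≡v

      2≤m : 2 ≤ m
      2≤m = ≤∧≢⇒< (n≢0⇒n>0 m≢0) (m≢1 ∘ sym)

      m∸j≤dv : ∀ {j} → b ≤ j → m ∸ j ≤ depth v
      m∸j≤dv b≤j = ≤-trans (∸-monoʳ-≤ m b≤j) (≤-trans (≤-reflexive (m+n∸m≡n b a)) a≤dv)

      depth-vertexAt-≤ : ∀ {j} → j ≤ b → depth (vertexAt j) ≡ depth u ∸ j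
      depth-vertexAt-≤ {j} j≤b = trans (cong depth (vertexAt-≤ j≤b)) (depth-iterate j u)

      depth-vertexAt-≥ : ∀ {j} → b ≤ j → depth (vertexAt j) ≡ depth v ∸ (m ∸ j)
      depth-vertexAt-≥ {j} b≤j = trans (cong depth (vertexAt-≥ b≤j)) (depth-iterate (m ∸ j) v)

      distinct-climbing : ∀ {i j} → i < j → j ≤ b → vertexAt i ≢ vertexAt j
      distinct-climbing i<j j≤b eq = <⇒≢ (∸-monoʳ-< i<j (≤-trans j≤b (m∸n≤m (depth u) ℓ)))
        (trans (sym (depth-vertexAt-≤ j≤b))
          (trans (cong depth (sym eq)) (depth-vertexAt-≤ (≤-trans (<⇒≤ i<j) j≤b))))

      distinct-descending : ∀ {i j} → b ≤ i → i < j → j ≤ m → vertexAt i ≢ vertexAt j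
      distinct-descending b≤i i<j j≤m eq = <⇒≢ (∸-monoʳ-< (∸-monoʳ-< i<j j≤m) (m∸j≤dv b≤i))
        (trans (sym (depth-vertexAt-≥ b≤i))
          (trans (cong depth eq) (depth-vertexAt-≥ (≤-trans b≤i (<⇒≤ i<j)))))

      -- two equal vertices on different sides would be a common ancestor deeper than ℓ
      distinct-across : ∀ {i j} → i < b → b < j → vertexAt i ≢ vertexAt j
      distinct-across {i} {j} i<b b<j eq = below-meet ℓ<dx dx≤du dx≤dv (begin
        ancestor u (depth x)   ≡⟨ ancestor-iterate u i≤du ⟩
        x                      ≡⟨ x≡y ⟩
        y                      ≡⟨ ancestor-iterate v (m∸j≤dv (<⇒≤ b<j)) ⟨
        ancestor v (depth y)   ≡⟨ cong (ancestor v ∘ depth) x≡y ⟨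
        ancestor v (depth x)   ∎)
        where
        open ≡-Reasoning
        x y : Fin n
        x = iterate parent u i
        y = iterate parent v (m ∸ j)
        x≡y : x ≡ y
        x≡y = trans (sym (vertexAt-≤ (<⇒≤ i<b))) (trans eq (vertexAt-≥ (<⇒≤ b<j)))
        i≤du : i ≤ depth u
        i≤du = ≤-trans (<⇒≤ i<b) (m∸n≤m (depth u) ℓ)
        ℓ<dx : ℓ < depth x
        ℓ<dx = subst (ℓ <_) (sym (depth-iterate i u)) (<∸⇒<∸ ℓ≤du i<b)
        dx≤du : depth x ≤ depth u
        dx≤du = subst (_≤ depth u) (sym (depth-iterate i u)) (m∸n≤m (depth u) i)
        dx≤dv : depth x ≤ depth v
        dx≤dv = subst (_≤ depth v) (sym (trans (cong depth x≡y) (depth-iterate (m ∸ j) v)))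
                  (m∸n≤m (depth v) (m ∸ j))

      distinct : ∀ {i j} → i < j → j < suc m → vertexAt i ≢ vertexAt j
      distinct {i} {j} i<j j<1+m with b <? j | b ≤? i
      ... | no b≮j  | _        = distinct-climbing i<j (≮⇒≥ b≮j)
      ... | yes _   | yes b≤i  = distinct-descending b≤i i<j (m<1+n⇒m≤n j<1+m)
      ... | yes b<j | no b≰i   = distinct-across (≰⇒> b≰i) b<j

      cycleSteps : All (uncurry CycleStep) (cyclicPairs G (applyUpTo vertexAt (suc m)))
      cycleSteps = All-cyclicZip vertexAt m step close

    fundamentalCycle : Cycle G
    fundamentalCycle = record
      { verts    = applyUpTo vertexAt (suc m)
      ; long     = subst (3 ≤_) (sym (length-applyUpTo vertexAt (suc m))) (s≤s 2≤m)
      ; distinct = applyUpTo⁺₁ vertexAt (suc m) distinct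
      ; edges-ok = All.map proj₁ cycleSteps
      }

    nonTreeEdge∈fundamentalCycle : EdgeOf G fundamentalCycle u v
    nonTreeEdge∈fundamentalCycle =
      inj₂ (subst₂ (λ x y → (x , y) ∈ cyclicPairs G (Cycle.verts fundamentalCycle)) vertexAt-m vertexAt-0
              (closing∈cyclicZip vertexAt m))

    edgeOf-fundamentalCycle : ∀ {x y} → EdgeOf G fundamentalCycle x y →
                              TreeEdge tree x y ⊎ (x ≡ u × y ≡ v) ⊎ (x ≡ v × y ≡ u)
    edgeOf-fundamentalCycle (inj₁ xy∈) with proj₂ (All.lookup cycleSteps xy∈)
    ... | inj₁ treeEdge       = inj₁ treeEdge
    ... | inj₂ (x≡v , y≡u)    = inj₂ (inj₂ (x≡v , y≡u))
    edgeOf-fundamentalCycle (inj₂ yx∈) with proj₂ (All.lookup cycleSteps yx∈)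
    ... | inj₁ (inj₁ y≡px)    = inj₁ (inj₂ y≡px)
    ... | inj₁ (inj₂ x≡py)    = inj₁ (inj₁ x≡py)
    ... | inj₂ (y≡v , x≡u)    = inj₂ (inj₁ (x≡u , y≡v))

module NonTreeEdges {n : ℕ} {G : Graph n} (tree : SpanningTree G) where
  open SpanningTree tree
  open FundamentalCycle tree

  -- each non-tree edge is listed once, with its endpoints in increasing order
  Oriented : Fin n × Fin n → Set
  Oriented (u , v) = toℕ u < toℕ v × NonTreeEdge tree u v

  oriented? : Decidable Oriented
  oriented? (u , v) = (toℕ u <? toℕ v) ×-dec (Adj? G u v ×-dec ¬? ((u ≟ᶠ parent v) ⊎-dec (v ≟ᶠ parent u)))

  nonTreeEdges : List (Fin n × Fin n)
  nonTreeEdges = filter oriented? (cartesianProduct (allFin n) (allFin n))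

  nonTreeEdges-unique : Unique nonTreeEdges
  nonTreeEdges-unique = filter⁺ oriented? (cartesianProduct⁺ (allFin⁺ n) (allFin⁺ n))

  oriented∈nonTreeEdges : ∀ {u v} → Oriented (u , v) → (u , v) ∈ nonTreeEdges
  oriented∈nonTreeEdges = ∈-filter⁺ oriented? (∈-cartesianProduct⁺ (∈-allFin _) (∈-allFin _))

  nonTreeEdges-oriented : ∀ i → Oriented (List.lookup nonTreeEdges i)
  nonTreeEdges-oriented i = proj₂ (∈-filter⁻ oriented? {xs = cartesianProduct (allFin n) (allFin n)} (∈-lookup i))

  blockers : Vec (Fin n) (length (map proj₁ nonTreeEdges))
  blockers = fromList (map proj₁ nonTreeEdges)

  blocks : ∀ {u v} → NonTreeEdge tree u v → Caught G blockers u ⊎ Caught G blockers v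
  blocks {u} {v} uv with <-cmp (toℕ u) (toℕ v)
  ... | tri< u<v _ _ = inj₁ (caught-fromList G (∈-map⁺ proj₁ (oriented∈nonTreeEdges (u<v , uv))))
  ... | tri≈ _ u≡v _ = contradiction (toℕ-injective u≡v) (Adj-irrefl G (proj₁ uv))
  ... | tri> _ _ v<u =
    inj₂ (caught-fromList G (∈-map⁺ proj₁ (oriented∈nonTreeEdges (v<u , NonTreeEdge-sym tree uv))))

  oriented-onFundamentalCycle : ∀ {e e′} (oriented-e : Oriented e) (oriented-e′ : Oriented e′) →
    EdgeOf G (fundamentalCycle (proj₂ oriented-e′)) (proj₁ e) (proj₂ e) → e ≡ e′
  oriented-onFundamentalCycle (u<v , _ , ¬treeEdge) (u′<v′ , e′-nonTree) onCycle
    with edgeOf-fundamentalCycle e′-nonTree onCycle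
  ... | inj₁ treeEdge             = contradiction treeEdge ¬treeEdge
  ... | inj₂ (inj₁ (refl , refl)) = refl
  ... | inj₂ (inj₂ (refl , refl)) = contradiction u′<v′ (<-asym u<v)

  length-nonTreeEdges≤ : ∀ {k} → AtMostCycles G k → length nonTreeEdges ≤ k
  length-nonTreeEdges≤ (cycles , |cycles|≤k , covered) =
    ≤-trans (≮⇒≥ λ fewerCycles → noCollision (pigeonhole fewerCycles slot)) |cycles|≤k
    where
    cycleOf : Fin (length nonTreeEdges) → Cycle G
    cycleOf i = fundamentalCycle (proj₂ (nonTreeEdges-oriented i))

    slot : Fin (length nonTreeEdges) → Fin (length cycles)
    slot i = Any.index (covered (cycleOf i))

    noCollision : ¬ (∃ λ i → ∃ λ j → i <ᶠ j × slot i ≡ slot j)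
    noCollision (i , j , i<j , same) = Unique⇒lookup-injective nonTreeEdges-unique i<j
      (oriented-onFundamentalCycle (nonTreeEdges-oriented i) (nonTreeEdges-oriented j)
        (Equivalence.from (Sj _ _) (Equivalence.to (Si _ _)
          (nonTreeEdge∈fundamentalCycle (proj₂ (nonTreeEdges-oriented i))))))
      where
      Si : SameCycle G (cycleOf i) (List.lookup cycles (slot i))
      Si = lookup-index (covered (cycleOf i))

      Sj : SameCycle G (cycleOf j) (List.lookup cycles (slot i))
      Sj = subst (SameCycle G (cycleOf j) ∘ List.lookup cycles) (sym same) (lookup-index (covered (cycleOf j)))

module Capture {n : ℕ} {G : Graph n} (tree : SpanningTree G) {m₁ m₂ : ℕ} (t : ℕ)
               (blockers : Vec (Fin n) m₁) (levelCops : Vec (Fin n) m₂)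
               (Guarded : ℕ → Set) (guarded? : Decidable Guarded)
               (blocks : ∀ {u v} → NonTreeEdge tree u v → Caught G blockers u ⊎ Caught G blockers v)
               (guards : ∀ {v} → Guarded (SpanningTree.depth tree v) → Caught G levelCops v)
               (dense : ∀ d → ∃ λ e → e ≤ d × d ≤ e + t × Guarded e)
               where
  open SpanningTree tree
  open Ancestors tree

  Unguarded : ℕ → ℕ → Set
  Unguarded lo hi = ∀ {e} → lo < e → e ≤ hi → ¬ Guarded e

  unguarded⇒≤ : ∀ {lo hi} → Unguarded lo hi → hi ≤ lo + t
  unguarded⇒≤ {lo} {hi} gap with dense hi
  ... | e , e≤hi , hi≤e+t , guarded-e = ≤-trans hi≤e+t (+-monoˡ-≤ t (≮⇒≥ λ lo<e → gap lo<e e≤hi guarded-e))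

  module Pursuit (c : Fin m₂) {s : Fin n} (levelCops[c]≡s : lookup levelCops c ≡ s) where

    cops : Fin n → Vec (Fin n) (m₁ + m₂)
    cops p = blockers ++ᵛ (levelCops [ c ]≔ p)

    caught-pursuer : ∀ p → Caught G (cops p) p
    caught-pursuer p = caught-++ʳ G blockers _ (c , lookup∘update c levelCops p)

    caught-blocker : ∀ {p w} → Caught G blockers w → Caught G (cops p) w
    caught-blocker = caught-++ˡ G blockers _

    caught-levelCop : ∀ {p w} → Caught G levelCops w → depth s < depth w → Caught G (cops p) w
    caught-levelCop {p} {w} (i , levelCopsᵢ≡w) s<w with i ≟ᶠ c
    ... | yes refl = contradiction (cong depth (trans (sym levelCops[c]≡s) levelCopsᵢ≡w)) (<⇒≢ s<w)
    ... | no  i≢c  = caught-++ʳ G blockers _ (i , trans (lookup∘update′ i≢c levelCops p) levelCopsᵢ≡w)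

    -- The pursuer c stands at p on the tree path from s to the robber r. No depth in
    -- (depth s, depth r] is guarded, so the robber never gets deeper than depth s + t,
    -- which the pursuer reaches within the remaining u rounds.
    record Invariant (u : ℕ) (p r : Fin n) : Set where
      field
        s≤p       : depth s ≤ depth p
        p<r       : depth p < depth r
        on-path   : ancestor r (depth p) ≡ p
        unguarded : Unguarded (depth s) (depth r)
        on-time   : depth s + t ≤ depth p + u
    open Invariant

    pursue : ∀ {u p r} → Invariant (suc u) p r → ¬ Caught G (cops (ancestor r (suc (depth p)))) r →
             Invariant u (ancestor r (suc (depth p))) r
    pursue {u} {p} {r} I r-free = record
      { s≤p       = ≤-trans (s≤p I) (≤-trans (n≤1+n (depth p)) (≤-reflexive (sym dp′)))
      ; p<r       = ≤∧≢⇒< (subst (_≤ depth r) (sym dp′) (p<r I)) λ dp′≡dr →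
                      r-free (subst (Caught G (cops p′)) (ancestor-self (trans (sym dp′≡dr) dp′)) (caught-pursuer p′))
      ; on-path   = cong (ancestor r) dp′
      ; unguarded = unguarded I
      ; on-time   = ≤-trans (on-time I) (≤-reflexive (trans (+-suc (depth p) u) (cong (_+ u) (sym dp′))))
      }
      where
      p′ : Fin n
      p′ = ancestor r (suc (depth p))
      dp′ : depth p′ ≡ suc (depth p)
      dp′ = depth-ancestor r (p<r I)

    robberClimbs : ∀ {u q r} → Invariant u q r → Caught G (cops q) (parent r) ⊎ Invariant u q (parent r)
    robberClimbs {u} {q} {r} I with depth q ≟ depth (parent r)
    ... | yes dq≡dpr = inj₁ (subst (Caught G (cops q)) q≡pr (caught-pursuer q))
      where
      q≡pr : q ≡ parent r
      q≡pr = begin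
        q                                        ≡⟨ on-path I ⟨
        ancestor r (depth q)                     ≡⟨ ancestor-parent (p<r I) ⟨
        ancestor (parent r) (depth q)            ≡⟨ ancestor-self (sym dq≡dpr) ⟩
        parent r                                 ∎
        where open ≡-Reasoning
    ... | no dq≢dpr = inj₂ record
      { s≤p       = s≤p I
      ; p<r       = ≤∧≢⇒< (subst (depth q ≤_) (sym (depth-parent r)) (<⇒≤pred (p<r I))) dq≢dpr
      ; on-path   = trans (ancestor-parent (p<r I)) (on-path I)
      ; unguarded = λ s<e e≤dpr →
                      unguarded I s<e (≤-trans e≤dpr (subst (_≤ depth r) (sym (depth-parent r)) pred[n]≤n))
      ; on-time   = on-time I
      }

    robberDescends : ∀ {u q r′} → Invariant u q (parent r′) → Caught G (cops q) r′ ⊎ Invariant u q r′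
    robberDescends {u} {q} {r′} I = descend (guarded? (depth r′))
      where
      dr′ : depth r′ ≡ suc (depth (parent r′))
      dr′ = depth-child (≤-<-trans z≤n (p<r I))

      q<r′ : depth q < depth r′
      q<r′ = <-trans (p<r I) (subst (depth (parent r′) <_) (sym dr′) (n<1+n _))

      unguarded′ : ¬ Guarded (depth r′) → Unguarded (depth s) (depth r′)
      unguarded′ ¬guarded-r′ s<e e≤r′ with m≤n⇒m<n∨m≡n (subst (_ ≤_) dr′ e≤r′)
      ... | inj₁ e<1+dpr′ = unguarded I s<e (m<1+n⇒m≤n e<1+dpr′)
      ... | inj₂ e≡1+dpr′ = subst (¬_ ∘ Guarded) (trans dr′ (sym e≡1+dpr′)) ¬guarded-r′

      descend : Dec (Guarded (depth r′)) → Caught G (cops q) r′ ⊎ Invariant u q r′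
      descend (yes guarded-r′) = inj₁ (caught-levelCop (guards guarded-r′) (≤-<-trans (s≤p I) q<r′))
      descend (no ¬guarded-r′) = inj₂ record
        { s≤p       = s≤p I
        ; p<r       = q<r′
        ; on-path   = trans (sym (ancestor-parent q<r′)) (on-path I)
        ; unguarded = unguarded′ ¬guarded-r′
        ; on-time   = on-time I
        }

    robberMoves : ∀ {u q r r′} → Invariant u q r → ¬ Caught G (cops q) r → Adj G r r′ →
                  Caught G (cops q) r′ ⊎ Invariant u q r′
    robberMoves {r = r} {r′} I r-free rr′ with r′ ≟ᶠ parent r | r ≟ᶠ parent r′
    ... | yes refl | _        = robberClimbs I
    ... | no _     | yes refl = robberDescends I
    ... | no r′≢pr | no r≢pr′ with blocks (rr′ , λ { (inj₁ r≡pr′) → r≢pr′ r≡pr′ ; (inj₂ r′≡pr) → r′≢pr r′≡pr })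
    ...   | inj₁ r-blocked  = contradiction (caught-blocker r-blocked) r-free
    ...   | inj₂ r′-blocked = inj₁ (caught-blocker r′-blocked)

    chase : ∀ u {p r} → Invariant u p r → CopsWin G u (cops p) r
    robberTurn : ∀ u {q r} → Invariant u q r → ¬ Caught G (cops q) r →
                 ∀ r′ → r′ ≡ r ⊎ Adj G r r′ → CopsWin G u (cops q) r′

    chase zero {p} {r} I = contradiction (begin-strict
      depth r         ≤⟨ unguarded⇒≤ (unguarded I) ⟩
      depth s + t     ≤⟨ on-time I ⟩
      depth p + 0     ≡⟨ +-identityʳ (depth p) ⟩
      depth p         <⟨ p<r I ⟩
      depth r         ∎) (n≮n (depth r))
      where open ≤-Reasoning
    chase (suc u) {p} {r} I = inj₂ (cops p′ , advance , respond)
      where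
      p′ : Fin n
      p′ = ancestor r (suc (depth p))

      p→p′ : Adj G p p′
      p→p′ = subst (λ x → Adj G x p′) (on-path I) (ancestor-adj (p<r I))

      advance : CopMove G (cops p) (cops p′)
      advance = copMove-++ʳ G blockers {levelCops [ c ]≔ p} {levelCops [ c ]≔ p′}
                  (copMove-update G levelCops c p→p′)

      respond : Caught G (cops p′) r ⊎ (∀ r′ → r′ ≡ r ⊎ Adj G r r′ → CopsWin G u (cops p′) r′)
      respond with caught? G (cops p′) r
      ... | yes caught = inj₁ caught
      ... | no  r-free = inj₂ (robberTurn u (pursue I r-free) r-free)

    robberTurn u I r-free r′ (inj₁ refl) = chase u I
    robberTurn u I r-free r′ (inj₂ rr′) with robberMoves I r-free rr′
    ... | inj₁ caught = caught⇒copsWin G u _ caught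
    ... | inj₂ I′     = chase u I′

  captLE : CaptLE G (blockers ++ᵛ levelCops) t
  captLE r with dense (depth r)
  ... | e , e≤dr , _ , guarded-e with greatestWitnessBelow guarded? (depth r) (e , e≤dr , guarded-e)
  ... | d , d≤dr , guarded-d , above = start (d ≟ depth r)
    where
    s : Fin n
    s = ancestor r d

    ds≡d : depth s ≡ d
    ds≡d = depth-ancestor r d≤dr

    s-guarded : Caught G levelCops s
    s-guarded = guards (subst Guarded (sym ds≡d) guarded-d)

    c : Fin m₂
    c = proj₁ s-guarded
    open Pursuit c (proj₂ s-guarded)

    cops-s : cops s ≡ blockers ++ᵛ levelCops
    cops-s = cong (blockers ++ᵛ_)
               (trans (cong (levelCops [ c ]≔_) (sym (proj₂ s-guarded))) ([]≔-lookup levelCops c))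

    start : Dec (d ≡ depth r) → CopsWin G t (blockers ++ᵛ levelCops) r
    start (yes d≡dr) = caught⇒copsWin G t _
      (caught-++ʳ G blockers levelCops (c , trans (proj₂ s-guarded) (ancestor-self (sym d≡dr))))
    start (no d≢dr)  = subst (λ cs → CopsWin G t cs r) cops-s (chase t record
      { s≤p       = ≤-refl
      ; p<r       = subst (_< depth r) (sym ds≡d) (≤∧≢⇒< d≤dr d≢dr)
      ; on-path   = cong (ancestor r) ds≡d
      ; unguarded = λ s<e → above (subst (_< _) ds≡d s<e)
      ; on-time   = ≤-refl
      })

module LevelClasses {n : ℕ} {G : Graph n} (tree : SpanningTree G) (t : ℕ) where
  open SpanningTree tree

  -- Class i guards the depths ≡ i (mod t + 1) and, through the root, depth 0, so that
  -- every depth has a guarded depth at most t above it.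
  Guarded : ℕ → ℕ → Set
  Guarded i d = d % suc t ≡ i ⊎ d ≡ 0

  guarded? : ∀ i → Decidable (Guarded i)
  guarded? i d = (d % suc t ≟ i) ⊎-dec (d ≟ 0)

  residue : Fin n → ℕ
  residue v = depth v % suc t

  rootUnless0 : ℕ → List (Fin n)
  rootUnless0 zero    = []
  rootUnless0 (suc _) = [ root ]

  levelClass : ℕ → List (Fin n)
  levelClass i = rootUnless0 i ++ filter (λ v → residue v ≟ i) (allFin n)

  guards : ∀ i {v} → Guarded i (depth v) → Caught G (fromList (levelClass i)) v
  guards i       {v} (inj₁ rv≡i) =
    caught-fromList G (∈-++⁺ʳ (rootUnless0 i) (∈-filter⁺ (λ w → residue w ≟ i) (∈-allFin v) rv≡i))
  guards zero    {v} (inj₂ dv≡0) =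
    caught-fromList G (∈-filter⁺ (λ w → residue w ≟ 0) (∈-allFin v) (cong (_% suc t) dv≡0))
  guards (suc i) {v} (inj₂ dv≡0) = caught-fromList G (here (depth≡0⇒root dv≡0))

  dense : ∀ {i} → i ≤ t → ∀ d → ∃ λ e → e ≤ d × d ≤ e + t × Guarded i e
  dense {i} i≤t d with d <? i
  ... | yes d<i = 0 , z≤n , ≤-trans (<⇒≤ d<i) i≤t , inj₂ refl
  ... | no  d≮i = e , e≤d , d≤e+t , inj₁ e%≡i
    where
    q r e : ℕ
    q = (d ∸ i) / suc t
    r = (d ∸ i) % suc t
    e = i + q * suc t

    d≡e+r : d ≡ e + r
    d≡e+r = begin
      d                                ≡⟨ m+[n∸m]≡n (≮⇒≥ d≮i) ⟨
      i + (d ∸ i)                      ≡⟨ cong (i +_) (m≡m%n+[m/n]*n (d ∸ i) (suc t)) ⟩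
      i + (r + q * suc t)              ≡⟨ rearrange i r (q * suc t) ⟩
      e + r                            ∎
      where
      open ≡-Reasoning
      rearrange : ∀ x y z → x + (y + z) ≡ (x + z) + y
      rearrange = solve-∀

    e≤d : e ≤ d
    e≤d = subst (e ≤_) (sym d≡e+r) (m≤m+n e r)

    d≤e+t : d ≤ e + t
    d≤e+t = subst (_≤ e + t) (sym d≡e+r) (+-monoʳ-≤ e (m<1+n⇒m≤n (m%n<n (d ∸ i) (suc t))))

    e%≡i : e % suc t ≡ i
    e%≡i = trans ([m+kn]%n≡m%n i q (suc t)) (m<n⇒m%n≡m (s≤s i≤t))

  sumBelow-levelClass : sumBelow (length ∘ levelClass) (suc t) ≡ t + n
  sumBelow-levelClass = begin
    sumBelow (length ∘ levelClass) (suc t)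
      ≡⟨ sumBelow-cong (suc t) (λ i → length-++ (rootUnless0 i)) ⟩
    sumBelow (λ i → length (rootUnless0 i) + countKey residue i (allFin n)) (suc t)
      ≡⟨ sumBelow-+ (length ∘ rootUnless0) (λ i → countKey residue i (allFin n)) (suc t) ⟩
    sumBelow (length ∘ rootUnless0) (suc t) + sumBelow (λ i → countKey residue i (allFin n)) (suc t)
      ≡⟨ cong₂ _+_ (roots t) (sumBelow-countKey residue (suc t) (allFin n) residues<) ⟩
    t + length (allFin n)
      ≡⟨ cong (t +_) (length-tabulate (λ v → v)) ⟩
    t + n
      ∎
    where
    open ≡-Reasoning
    roots : ∀ j → sumBelow (length ∘ rootUnless0) (suc j) ≡ j
    roots zero    = refl
    roots (suc j) = trans (cong (_+ 1) (roots j)) (+-comm j 1)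

    residues< : All (λ v → residue v < suc t) (allFin n)
    residues< = All.universal (λ v → m%n<n (depth v) (suc t)) (allFin n)

throttleLE-levelClass : ∀ {n k} {G : Graph n} (tree : SpanningTree G) → AtMostCycles G k →
                        ∀ t {i} → i ≤ t → ThrottleLE G (k + length (LevelClasses.levelClass tree t i) + t)
throttleLE-levelClass {k = k} tree atMost t {i} i≤t =
  m₁ + m₂ , t , (blockers ++ᵛ fromList (levelClass i) , captLE) , +-monoˡ-≤ t (+-monoˡ-≤ m₂ m₁≤k)
  where
  open NonTreeEdges tree using (blockers; blocks; nonTreeEdges; length-nonTreeEdges≤)
  open LevelClasses tree t
  open Capture tree t blockers (fromList (levelClass i)) (Guarded i) (guarded? i) blocks (guards i) (dense i≤t)

  m₁ m₂ : ℕ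
  m₁ = length (map proj₁ nonTreeEdges)
  m₂ = length (levelClass i)

  m₁≤k : m₁ ≤ k
  m₁≤k = ≤-trans (≤-reflexive (length-map proj₁ nonTreeEdges)) (length-nonTreeEdges≤ atMost)

throttle≤2√n+k-fromTree : ∀ {n k} {G : Graph n} → SpanningTree G → AtMostCycles G k → ThrottleLE-2sqrt+ G k
throttle≤2√n+k-fromTree {n} {k} tree atMost
  with betweenSquares n (>-nonZero⁻¹ n {{nonZeroIndex (SpanningTree.root tree)}})
... | b , b²<n , n≤[1+b]² with termBelowAverage (length ∘ LevelClasses.levelClass tree b) b
... | i , i≤b , [1+b]m≤sum = k + m + b , throttleLE-levelClass tree atMost b i≤b , bound
  where
  m : ℕ
  m = length (LevelClasses.levelClass tree b i)

  bound : (k + m + b ∸ k) * (k + m + b ∸ k) ≤ 4 * n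
  bound = subst (λ y → y * y ≤ 4 * n) (sym (trans (cong (_∸ k) (+-assoc k m b)) (m+n∸m≡n k (m + b))))
            ([m+b]²≤4n b²<n n≤[1+b]²
              (≤-trans [1+b]m≤sum (≤-reflexive (trans (LevelClasses.sumBelow-levelClass tree b) (+-comm b n)))))

throttle≤2√n+k : ∀ {n} (G : Graph n) k → Connected G → AtMostCycles G k → ThrottleLE-2sqrt+ G k
throttle≤2√n+k {zero}  G k _         _ =
  0 , (0 , 0 , ([] , λ ()) , z≤n) , subst (λ y → y * y ≤ 0) (sym (0∸n≡0 k)) z≤n
throttle≤2√n+k {suc n} G k connected   = throttle≤2√n+k-fromTree (BreadthFirst.bfsTree G connected zero)

corollary2p11 : ((n : ℕ) (G : Graph n) (k : ℕ) → Connected G → AtMostCycles G k → ThrottleLE-2sqrt+ G k)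
    × ((n : ℕ) (G : Graph n) → Connected G → Unicyclic G → ThrottleLE-2sqrt+ G 1)
corollary2p11 = (λ n G k → throttle≤2√n+k G k)
              , (λ n G connected unicyclic → throttle≤2√n+k G 1 connected (proj₂ unicyclic))
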